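{- For every $n\ge-1$, $\mathrm{cil}_0\,\gamma_+[n]=|\mathrm{Cil}_0\Gamma_+[n]|$; equivalently, $\mathrm{cil}_0=|\mathrm{Cil}_0|$.
   Context: Sequences indexed by $\mathbb{N}_+=\{ -1,0,1,\dots\}$. Define $\breve{\mathrm{cil}}_0\,\gamma_+[j]_m=(j+2)\delta_{j,m}$ and $\mathrm{cil}_0\,\gamma_+[n]=\sum_{j=-1}^{n}\binom{1+n}{1+j}\breve{\mathrm{cil}}_0\,\gamma_+[j]$, and let $\mathrm{cil}_0$ be the matrix with $(n,m)$ entry $\mathrm{cil}_0\,\gamma_+[n]_m$. Geometric side: $[n]=\{0<\dots<n\}$ ($n\ge0$), $[-1]=\emptyset$; $\Gamma_+[n]_p$ = strictly increasing maps $[p]\to[n]$. For $\sigma\in\Gamma_+[n]_p$, $\tau\in\Gamma_+[n]_q$, $\sigma\prec\tau$ means $\sigma([p])\cap\tau([q])=\emptyset$ and $\sigma(i)<\tau(j)$ for all $i,j$. $\mathrm{Cil}_0\Gamma_+[n]_m=\{(\sigma,\tau)\in\Gamma_+[n]_p\times\Gamma_+[n]_q:p,q\ge-1,\ p+q=m-1,\ \sigma\prec\tau\}$ with faces $d_i(\sigma,\tau)=(d_i\sigma,\tau)$ for $i\le p$, $(\sigma,d_{i-p-1}\tau)$ for $i>p$; functorial in $[n]$ by postcomposition. $|\mathrm{Cil}_0|$ is the matrix with $(n,m)$ entry $|\mathrm{Cil}_0\Gamma_+[n]_m|$. -}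

module Defs where

-- Index shift convention: the paper's indices n, m, j ∈ ℕ₊ = {-1,0,1,…}
-- are represented by N = n+1, M = m+1, J = j+1 ∈ ℕ.

open import Data.Nat using (ℕ; zero; suc; _+_; _*_)
open import Data.Nat.Combinatorics using (_C_)
open import Data.Fin using (Fin) renaming (_<_ to _<ᶠ_)
open import Data.Vec using (Vec)
open import Data.Vec.Relation.Unary.Linked using (Linked)
open import Data.Vec.Relation.Unary.All using (All)
open import Data.Product using (Σ; Σ-syntax; _×_; proj₁)
open import Relation.Binary.PropositionalEquality using (_≡_)
open import Relation.Nullary using (yes; no)
open import Data.Nat using (_≟_)

-- breve-cil₀ γ₊[j]_m = (j+2) δ_{j,m};  with J = j+1, M = m+1: (J+1) δ_{J,M}
breveCil0 : ℕ → ℕ → ℕ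
breveCil0 J M with J ≟ M
... | yes _ = suc J
... | no  _ = 0

sumTo : ℕ → (ℕ → ℕ) → ℕ
sumTo zero    f = f 0
sumTo (suc K) f = sumTo K f + f (suc K)

-- cil₀ γ₊[n]_m = Σ_{j=-1}^{n} C(1+n,1+j) · breve-cil₀ γ₊[j]_m
-- with N = n+1, M = m+1, J = j+1 ranging over 0..N.
cil0 : ℕ → ℕ → ℕ
cil0 N M = sumTo N (λ J → (N C J) * breveCil0 J M)

-- Γ₊[n]_p with N = n+1, k = p+1: strictly increasing maps [p] → [n],
-- i.e. maps Fin k → Fin N, represented by their list of values
-- (a vector of length k) which is strictly increasing.
Γ₊ : (N k : ℕ) → Set
Γ₊ N k = Σ[ v ∈ Vec (Fin N) k ] Linked _<ᶠ_ v

_≺_ : ∀ {N k l} → Γ₊ N k → Γ₊ N l → Set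
σ ≺ τ = All (λ x → All (λ y → x <ᶠ y) (proj₁ τ)) (proj₁ σ)

-- Cil₀Γ₊[n]_m with N = n+1, M = m+1:
-- pairs (σ, τ) ∈ Γ₊[n]_p × Γ₊[n]_q, p,q ≥ -1, p+q = m-1, σ ≺ τ;
-- with k = p+1, l = q+1 the condition p+q = m-1 becomes k+l = M.
Cil0Γ₊ : (N M : ℕ) → Set
Cil0Γ₊ N M =
  Σ[ k ∈ ℕ ] Σ[ l ∈ ℕ ] (k + l ≡ M) ×
    (Σ[ σ ∈ Γ₊ N k ] Σ[ τ ∈ Γ₊ N l ] (σ ≺ τ))

-- A pair σ ≺ τ of increasing sequences is the same thing as one increasing
-- sequence σ ++ τ of length k + l cut after its first k entries. Hence the
-- pairs with k + l = M are counted by (M + 1) · C(N, M), increasing sequences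
-- being counted by Pascal's rule (split on whether 0 occurs). On the algebraic
-- side the Kronecker delta in breveCil0 collapses the defining sum of cil0 to
-- the single term C(N, M) · (M + 1).
module Submission where

open import Defs
open import Data.Nat using (ℕ; zero; suc; _+_; _*_; _≤_; _<_; _≤?_; _≟_; z≤n; s≤s)
import Data.Nat.Properties as ℕ
open import Data.Nat.Combinatorics using (_C_; k>n⇒nCk≡0; nCk+nC[k+1]≡[n+1]C[k+1])
open import Data.Fin using (Fin; zero; suc) renaming (_<_ to _<ᶠ_)
open import Data.Fin.Properties using (+↔⊎; *↔×; 1↔⊤; <-trans; <-irrelevant)
open import Data.Vec using (Vec; []; _∷_; _++_; map; take; drop)
open import Data.Vec.Properties using (take++drop≡id; ++-injective)
open import Data.Vec.Relation.Unary.Linked as Linked using (Linked; []; [-]; _∷_)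
open import Data.Vec.Relation.Unary.Linked.Properties using (Linked⇒All; map⁺; map⁻)
open import Data.Vec.Relation.Unary.All as All using (All; []; _∷_)
import Data.Vec.Relation.Unary.All.Properties as All
open import Data.Product using (Σ-syntax; _×_; _,_; proj₁)
open import Data.Sum using (_⊎_; inj₁; inj₂)
open import Data.Unit using (⊤; tt)
open import Relation.Binary using (Rel; Transitive)
open import Relation.Binary.PropositionalEquality
open import Relation.Nullary using (yes; no; contradiction)
open import Function.Base using (_∘_)
open import Function.Bundles using (_↔_; mk↔ₛ′; Inverse)
open import Function.Properties.Inverse using (↔-trans; ↔-sym)
open import Data.Sum.Function.Propositional using (_⊎-↔_)
open import Data.Product.Function.NonDependent.Propositional using (_×-↔_)
open import Function.Related.Propositional using (module EquationalReasoning)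

private variable
  N M k l : ℕ

module _ {a r} {A : Set a} {R : Rel A r} where

  Linked-∷⁺ : ∀ {x} {xs : Vec A k} → All (R x) xs → Linked R xs → Linked R (x ∷ xs)
  Linked-∷⁺ []      []  = [-]
  Linked-∷⁺ (p ∷ _) lxs = p ∷ lxs

  Linked-++⁺ : {xs : Vec A k} {ys : Vec A l} → Linked R xs → Linked R ys →
               All (λ x → All (R x) ys) xs → Linked R (xs ++ ys)
  Linked-++⁺ {xs = []}        _         lys _        = lys
  Linked-++⁺ {xs = _ ∷ []}    _         lys (p ∷ []) = Linked-∷⁺ p lys
  Linked-++⁺ {xs = _ ∷ _ ∷ _} (q ∷ lxs) lys (_ ∷ ps) = q ∷ Linked-++⁺ lxs lys ps

  module _ (R-trans : Transitive R) where

    Linked-∷⁻ : ∀ {x} {xs : Vec A k} → Linked R (x ∷ xs) → All (R x) xs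
    Linked-∷⁻ {xs = []}    _         = []
    Linked-∷⁻ {xs = _ ∷ _} (p ∷ lxs) = Linked⇒All R-trans p lxs

    Linked-++⁻ : (xs : Vec A k) {ys : Vec A l} → Linked R (xs ++ ys) →
                 Linked R xs × Linked R ys × All (λ x → All (R x) ys) xs
    Linked-++⁻ []       lys = [] , lys , []
    Linked-++⁻ (x ∷ xs) lxys =
      let lxs , lys , ps = Linked-++⁻ xs (Linked.tail lxys)
          px  , py       = All.++⁻ xs (Linked-∷⁻ lxys)
      in  Linked-∷⁺ px lxs , lys , py ∷ ps

Γ₊-≡ : {σ τ : Γ₊ N k} → proj₁ σ ≡ proj₁ τ → σ ≡ τ
Γ₊-≡ {σ = v , p} {τ = .v , q} refl = cong (v ,_) (Linked.irrelevant <-irrelevant p q)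

≺-Pairs : ℕ → ℕ → ℕ → Set
≺-Pairs N k l = Σ[ σ ∈ Γ₊ N k ] Σ[ τ ∈ Γ₊ N l ] (σ ≺ τ)

≺-Pairs-≡ : {σ σ′ : Γ₊ N k} {τ τ′ : Γ₊ N l} {p : σ ≺ τ} {p′ : σ′ ≺ τ′} →
            σ ≡ σ′ → τ ≡ τ′ → _≡_ {A = ≺-Pairs N k l} (σ , τ , p) (σ′ , τ′ , p′)
≺-Pairs-≡ {σ = σ} {τ = τ} refl refl =
  cong (λ p → σ , τ , p) (All.irrelevant (All.irrelevant <-irrelevant) _ _)

≺-Pairs↔Γ₊ : ≺-Pairs N k l ↔ Γ₊ N (k + l)
≺-Pairs↔Γ₊ {N} {k} {l} = mk↔ₛ′ concat split concat∘split split∘concat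
  where
  concat : ≺-Pairs N k l → Γ₊ N (k + l)
  concat ((v , lv) , (t , lt) , p) = v ++ t , Linked-++⁺ lv lt p

  split : Γ₊ N (k + l) → ≺-Pairs N k l
  split (w , lw) =
    let lv , lt , p = Linked-++⁻ <-trans (take k w) (subst (Linked _<ᶠ_) (sym (take++drop≡id k w)) lw)
    in  (take k w , lv) , (drop k w , lt) , p

  concat∘split : ∀ σ → concat (split σ) ≡ σ
  concat∘split (w , _) = Γ₊-≡ (take++drop≡id k w)

  split∘concat : ∀ x → split (concat x) ≡ x
  split∘concat ((v , _) , (t , _) , _) =
    let take≡v , drop≡t = ++-injective (take k (v ++ t)) v (take++drop≡id k (v ++ t))
    in  ≺-Pairs-≡ (Γ₊-≡ take≡v) (Γ₊-≡ drop≡t)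

Positive : Fin (suc N) → Set
Positive {N} = zero {N} <ᶠ_

unshift : (w : Vec (Fin (suc N)) k) → All Positive w → Vec (Fin N) k
unshift []          []      = []
unshift (suc y ∷ w) (_ ∷ p) = y ∷ unshift w p

map-suc-unshift : (w : Vec (Fin (suc N)) k) (p : All Positive w) → map suc (unshift w p) ≡ w
map-suc-unshift []          []      = refl
map-suc-unshift (suc y ∷ w) (_ ∷ p) = cong (suc y ∷_) (map-suc-unshift w p)

unshift-map-suc : (v : Vec (Fin N) k) (p : All Positive (map suc v)) → unshift (map suc v) p ≡ v
unshift-map-suc []      []      = refl
unshift-map-suc (y ∷ v) (_ ∷ p) = cong (y ∷_) (unshift-map-suc v p)

All-Positive-map-suc : (v : Vec (Fin N) k) → All Positive (map suc v)
All-Positive-map-suc v = All.map⁺ (All.universal (λ _ → s≤s z≤n) v)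

Linked-map-suc : {v : Vec (Fin N) k} → Linked _<ᶠ_ v → Linked _<ᶠ_ (map suc v)
Linked-map-suc lv = map⁺ (Linked.map s≤s lv)

Linked-unshift : (w : Vec (Fin (suc N)) k) (p : All Positive w) →
                 Linked _<ᶠ_ w → Linked _<ᶠ_ (unshift w p)
Linked-unshift w p lw =
  Linked.map ℕ.≤-pred (map⁻ (subst (Linked _<ᶠ_) (sym (map-suc-unshift w p)) lw))

Γ₊-pascal : Γ₊ (suc N) (suc k) ↔ (Γ₊ N k ⊎ Γ₊ N (suc k))
Γ₊-pascal {N} {k} = mk↔ₛ′ to from to∘from from∘to
  where
  to : Γ₊ (suc N) (suc k) → Γ₊ N k ⊎ Γ₊ N (suc k)
  to (zero ∷ w , lw) = inj₁ (unshift w p , Linked-unshift w p (Linked.tail lw))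
    where p = Linked-∷⁻ <-trans lw
  to (suc y ∷ w , lw) = inj₂ (unshift (suc y ∷ w) p , Linked-unshift (suc y ∷ w) p lw)
    where p = Linked⇒All <-trans (s≤s z≤n) lw

  from : Γ₊ N k ⊎ Γ₊ N (suc k) → Γ₊ (suc N) (suc k)
  from (inj₁ (v , lv)) = zero ∷ map suc v , Linked-∷⁺ (All-Positive-map-suc v) (Linked-map-suc lv)
  from (inj₂ (v , lv)) = map suc v , Linked-map-suc lv

  to∘from : ∀ x → to (from x) ≡ x
  to∘from (inj₁ (v , _))     = cong inj₁ (Γ₊-≡ (unshift-map-suc v _))
  to∘from (inj₂ (y ∷ v , _)) = cong inj₂ (Γ₊-≡ (unshift-map-suc (y ∷ v) _))

  from∘to : ∀ σ → from (to σ) ≡ σ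
  from∘to (zero ∷ w , _)  = Γ₊-≡ (cong (zero ∷_) (map-suc-unshift w _))
  from∘to (suc y ∷ w , _) = Γ₊-≡ (map-suc-unshift (suc y ∷ w) _)

Γ₊↔Fin-C : ∀ N k → Γ₊ N k ↔ Fin (N C k)
Γ₊↔Fin-C N       zero    = mk↔ₛ′ (λ _ → zero) (λ _ → [] , []) (λ { zero → refl }) (λ { ([] , []) → refl })
Γ₊↔Fin-C zero    (suc k) = mk↔ₛ′ (λ { (() ∷ _ , _) }) (λ ()) (λ ()) (λ { (() ∷ _ , _) })
Γ₊↔Fin-C (suc N) (suc k) = begin
  Γ₊ (suc N) (suc k)               ↔⟨ Γ₊-pascal ⟩
  (Γ₊ N k ⊎ Γ₊ N (suc k))          ↔⟨ Γ₊↔Fin-C N k ⊎-↔ Γ₊↔Fin-C N (suc k) ⟩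
  (Fin (N C k) ⊎ Fin (N C suc k))  ↔⟨ +↔⊎ ⟨
  Fin (N C k + N C suc k)          ≡⟨ cong Fin (nCk+nC[k+1]≡[n+1]C[k+1] N k) ⟩
  Fin (suc N C suc k)              ∎
  where open EquationalReasoning

Decomposition : ℕ → Set
Decomposition M = Σ[ k ∈ ℕ ] Σ[ l ∈ ℕ ] k + l ≡ M

Decomposition↔Fin : ∀ M → Decomposition M ↔ Fin (suc M)
Decomposition↔Fin zero =
  mk↔ₛ′ (λ _ → zero) (λ _ → 0 , 0 , refl) (λ { zero → refl }) (λ { (0 , 0 , refl) → refl })
Decomposition↔Fin (suc M) =
  ↔-trans split (↔-trans (↔-sym 1↔⊤ ⊎-↔ Decomposition↔Fin M) (↔-sym +↔⊎))
  where
  split : Decomposition (suc M) ↔ (⊤ ⊎ Decomposition M)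
  split = mk↔ₛ′
    (λ { (zero , _ , _) → inj₁ tt ; (suc k , l , e) → inj₂ (k , l , ℕ.suc-injective e) })
    (λ { (inj₁ tt) → 0 , suc M , refl ; (inj₂ (k , l , e)) → suc k , l , cong suc e })
    (λ { (inj₁ tt) → refl ; (inj₂ (k , l , refl)) → refl })
    (λ { (zero , l , refl) → refl ; (suc k , l , refl) → refl })

Σ-Decomposition-↔ : {X : ℕ → ℕ → Set} {Y : ℕ → Set} → (∀ k l → X k l ↔ Y (k + l)) →
                    (Σ[ k ∈ ℕ ] Σ[ l ∈ ℕ ] (k + l ≡ M) × X k l) ↔ (Decomposition M × Y M)
Σ-Decomposition-↔ X↔Y = mk↔ₛ′
  (λ { (k , l , refl , x) → (k , l , refl) , to (X↔Y k l) x })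
  (λ { ((k , l , refl) , y) → k , l , refl , from (X↔Y k l) y })
  (λ { ((k , l , refl) , y) → cong ((k , l , refl) ,_) (strictlyInverseˡ (X↔Y k l) y) })
  (λ { (k , l , refl , x) → cong (λ x → k , l , refl , x) (strictlyInverseʳ (X↔Y k l) x) })
  where open Inverse

breveCil0-diagonal : ∀ M → breveCil0 M M ≡ suc M
breveCil0-diagonal M with M ≟ M
... | yes _  = refl
... | no M≢M = contradiction refl M≢M

breveCil0-off-diagonal : ∀ {J M} → J ≢ M → breveCil0 J M ≡ 0
breveCil0-off-diagonal {J} {M} J≢M with J ≟ M
... | yes J≡M = contradiction J≡M J≢M
... | no _    = refl

module _ (f : ℕ → ℕ) {M : ℕ} (supported : ∀ {J} → J ≢ M → f J ≡ 0) where

  sumTo-below-support : ∀ {K} → K < M → sumTo K f ≡ 0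
  sumTo-below-support {zero}  K<M = supported (ℕ.<⇒≢ K<M)
  sumTo-below-support {suc K} K<M =
    cong₂ _+_ (sumTo-below-support (ℕ.<-trans (ℕ.n<1+n K) K<M)) (supported (ℕ.<⇒≢ K<M))

  sumTo-above-support : ∀ {K} → M ≤ K → sumTo K f ≡ f M
  sumTo-above-support {zero}  z≤n = refl
  sumTo-above-support {suc K} M≤K with M ≟ suc K
  ... | yes refl = cong (_+ f M) (sumTo-below-support (ℕ.n<1+n K))
  ... | no M≢K   = begin
    sumTo K f + f (suc K) ≡⟨ cong₂ _+_ (sumTo-above-support (ℕ.≤-pred (ℕ.≤∧≢⇒< M≤K M≢K)))
                                        (supported (M≢K ∘ sym)) ⟩
    f M + 0               ≡⟨ ℕ.+-identityʳ (f M) ⟩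
    f M                   ∎
    where open ≡-Reasoning

*-breveCil0-off-diagonal : ∀ a {J M} → J ≢ M → a * breveCil0 J M ≡ 0
*-breveCil0-off-diagonal a J≢M = trans (cong (a *_) (breveCil0-off-diagonal J≢M)) (ℕ.*-zeroʳ a)

cil0-closed-form : ∀ N M → cil0 N M ≡ suc M * (N C M)
cil0-closed-form N M with M ≤? N
... | yes M≤N = begin
  cil0 N M                ≡⟨ sumTo-above-support (λ J → (N C J) * breveCil0 J M)
                               (λ {J} → *-breveCil0-off-diagonal (N C J)) M≤N ⟩
  (N C M) * breveCil0 M M ≡⟨ cong ((N C M) *_) (breveCil0-diagonal M) ⟩
  (N C M) * suc M         ≡⟨ ℕ.*-comm (N C M) (suc M) ⟩
  suc M * (N C M)         ∎
  where open ≡-Reasoning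
... | no M≰N = begin
  cil0 N M              ≡⟨ sumTo-below-support (λ J → (N C J) * breveCil0 J M)
                             (λ {J} → *-breveCil0-off-diagonal (N C J)) (ℕ.≰⇒> M≰N) ⟩
  0                     ≡⟨ ℕ.*-zeroʳ (suc M) ⟨
  suc M * 0             ≡⟨ cong (suc M *_) (k>n⇒nCk≡0 (ℕ.≰⇒> M≰N)) ⟨
  suc M * (N C M)       ∎
  where open ≡-Reasoning

mainTheorem10 : (N M : ℕ) → Cil0Γ₊ N M ↔ Fin (cil0 N M)
mainTheorem10 N M = begin
  Cil0Γ₊ N M                  ↔⟨ Σ-Decomposition-↔ {Y = Γ₊ N} (λ k l → ≺-Pairs↔Γ₊) ⟩
  (Decomposition M × Γ₊ N M)  ↔⟨ Decomposition↔Fin M ×-↔ Γ₊↔Fin-C N M ⟩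
  (Fin (suc M) × Fin (N C M)) ↔⟨ *↔× ⟨
  Fin (suc M * (N C M))       ≡⟨ cong Fin (cil0-closed-form N M) ⟨
  Fin (cil0 N M)              ∎
  where open EquationalReasoning
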